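{- Let $p$ be a prime, $\mathcal{O}$ a maximal order of $B_p$, and $u,v\in\mathcal{O}^T$. Then $uv-\tfrac12\mathrm{Tr}(uv)\in\mathcal{O}^T\cap\langle u,v\rangle^\perp$, where $\langle u,v\rangle^\perp := \{t\in B_p : \mathrm{Tr}(t\bar u)=\mathrm{Tr}(t\bar v)=0\}$.
   Context: $B_p$ is the quaternion algebra over $\mathbb{Q}$ ramified exactly at $p$ and $\infty$, with canonical involution $x\mapsto\bar x$ and reduced trace $\mathrm{Tr}(x)=x+\bar x$. A maximal order is a subring containing $\mathbb{Z}$, a $\mathbb{Z}$-lattice of rank $4$, not properly contained in another order. $\mathcal{O}^T := \{2a-\mathrm{Tr}(a) : a\in\mathcal{O}\}$. -}

module Defs where

open import Data.Nat as ℕ using (ℕ; zero; suc; _%_; _≡ᵇ_; _^_)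
open import Data.Nat.Primality using (Prime)
open import Data.Integer as ℤ using (ℤ; +_)
open import Data.Integer.DivMod using (_%ℕ_)
open import Data.Integer.Divisibility using () renaming (_∣_ to _∣ℤ_)
open import Data.Rational as ℚ using (ℚ; 0ℚ; 1ℚ; ½; _/_)
open import Data.Bool using (Bool; true; false; not; _∧_; _∨_; _xor_; T; if_then_else_)
open import Data.List using (upTo)
open import Data.Bool.ListAction using (any)
open import Data.Fin using (Fin) renaming (zero to fz; suc to fs)
open import Data.Product using (Σ; _×_; ∃; ∃-syntax)
open import Relation.Nullary using (¬_)
open import Relation.Binary.PropositionalEquality using (_≡_; _≢_)

-- The quaternion algebra (a,b)_ℚ with basis 1, i, j, k = ij,
-- i² = a, j² = b, ij = -ji.  Elements are 4-tuples of rationals.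

i0 i1 i2 i3 : Fin 4
i0 = fz
i1 = fs fz
i2 = fs (fs fz)
i3 = fs (fs (fs fz))

record Quat : Set where
  constructor ⟨_,_,_,_⟩
  field
    x₀ x₁ x₂ x₃ : ℚ
open Quat public

module QuatAlg (a b : ℤ) where
  private
    α β : ℚ
    α = a / 1
    β = b / 1

  _+Q_ : Quat → Quat → Quat
  ⟨ x0 , x1 , x2 , x3 ⟩ +Q ⟨ y0 , y1 , y2 , y3 ⟩ =
    ⟨ x0 ℚ.+ y0 , x1 ℚ.+ y1 , x2 ℚ.+ y2 , x3 ℚ.+ y3 ⟩

  -Q_ : Quat → Quat
  -Q ⟨ x0 , x1 , x2 , x3 ⟩ = ⟨ ℚ.- x0 , ℚ.- x1 , ℚ.- x2 , ℚ.- x3 ⟩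

  _-Q_ : Quat → Quat → Quat
  x -Q y = x +Q (-Q y)

  _*Q_ : Quat → Quat → Quat
  ⟨ x0 , x1 , x2 , x3 ⟩ *Q ⟨ y0 , y1 , y2 , y3 ⟩ =
    ⟨ x0 ℚ.* y0 ℚ.+ α ℚ.* (x1 ℚ.* y1) ℚ.+ β ℚ.* (x2 ℚ.* y2) ℚ.- (α ℚ.* β) ℚ.* (x3 ℚ.* y3)
    , x0 ℚ.* y1 ℚ.+ x1 ℚ.* y0 ℚ.- β ℚ.* (x2 ℚ.* y3) ℚ.+ β ℚ.* (x3 ℚ.* y2)
    , x0 ℚ.* y2 ℚ.+ x2 ℚ.* y0 ℚ.+ α ℚ.* (x1 ℚ.* y3) ℚ.- α ℚ.* (x3 ℚ.* y1)
    , x0 ℚ.* y3 ℚ.+ x3 ℚ.* y0 ℚ.+ x1 ℚ.* y2 ℚ.- x2 ℚ.* y1 ⟩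

  ι : ℚ → Quat
  ι q = ⟨ q , 0ℚ , 0ℚ , 0ℚ ⟩

  _·Q_ : ℚ → Quat → Quat
  q ·Q x = ι q *Q x

  0Q 1Q : Quat
  0Q = ι 0ℚ
  1Q = ι 1ℚ

  conj : Quat → Quat
  conj ⟨ x0 , x1 , x2 , x3 ⟩ = ⟨ x0 , ℚ.- x1 , ℚ.- x2 , ℚ.- x3 ⟩

  Tr : Quat → ℚ
  Tr x = x₀ (x +Q conj x)

  Subset : Set₁
  Subset = Quat → Set

  ℤ-comb : (Fin 4 → Quat) → (Fin 4 → ℤ) → Quat
  ℤ-comb e c = ((c i0 / 1) ·Q e i0) +Q (((c i1 / 1) ·Q e i1) +Q (((c i2 / 1) ·Q e i2) +Q ((c i3 / 1) ·Q e i3)))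

  ℚ-comb : (Fin 4 → Quat) → (Fin 4 → ℚ) → Quat
  ℚ-comb e c = (c i0 ·Q e i0) +Q ((c i1 ·Q e i1) +Q ((c i2 ·Q e i2) +Q (c i3 ·Q e i3)))

  IsLatticeRank4 : Subset → Set
  IsLatticeRank4 O = Σ (Fin 4 → Quat) λ e →
      ((∀ x → O x → ∃[ c ] x ≡ ℤ-comb e c) × (∀ c → O (ℤ-comb e c)))
    × (∀ q → ℚ-comb e q ≡ 0Q → ∀ i → q i ≡ 0ℚ)

  IsSubring : Subset → Set
  IsSubring O = O 1Q × (∀ x y → O x → O y → O (x +Q y))
              × (∀ x → O x → O (-Q x)) × (∀ x y → O x → O y → O (x *Q y))

  IsOrder : Subset → Set
  IsOrder O = IsSubring O × IsLatticeRank4 O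

  IsMaximalOrder : Subset → Set₁
  IsMaximalOrder O = IsOrder O ×
    (∀ (O' : Subset) → IsOrder O' → (∀ x → O x → O' x) → ∀ x → O' x → O x)

  _ᵀ : Subset → Subset
  (O ᵀ) x = Σ Quat λ y → O y × x ≡ ((2ℚ ·Q y) -Q ι (Tr y))
    where 2ℚ = + 2 / 1

  ⊥⟨_,_⟩ : Quat → Quat → Subset
  ⊥⟨ u , v ⟩ t = (Tr (t *Q conj u) ≡ 0ℚ) × (Tr (t *Q conj v) ≡ 0ℚ)

-- Ramification of (a,b)_ℚ, a,b nonzero integers, via Hilbert symbols
-- (Serre, A Course in Arithmetic, Ch. III, Thm. 1).  The Hilbert symbol
-- (a,b)_ℓ is -1 iff the corresponding Bool "bit" is true.

oddB : ℕ → Bool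
oddB n = n % 2 ≡ᵇ 1

isSqMod : ℕ → ℤ → Bool
isSqMod zero u = false
isSqMod (suc m) u = any (λ x → (x ℕ.* x) % suc m ≡ᵇ (u %ℕ suc m)) (upTo (suc m))

-- ε(u) mod 2 and ω(u) mod 2 for an odd integer u
εB ωB : ℤ → Bool
εB u = u %ℕ 4 ≡ᵇ 3
ωB u = (u %ℕ 8 ≡ᵇ 3) ∨ (u %ℕ 8 ≡ᵇ 5)

-- a = ℓ^α u, b = ℓ^β v with u, v units at ℓ
hilbertBit : (ℓ α β : ℕ) (u v : ℤ) → Bool
hilbertBit ℓ α β u v =
  if ℓ ≡ᵇ 2
  then ((εB u ∧ εB v) xor (oddB α ∧ ωB v)) xor (oddB β ∧ ωB u)
  else ((oddB α ∧ oddB β ∧ (ℓ % 4 ≡ᵇ 3)) xor (oddB β ∧ not (isSqMod ℓ u)))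
         xor (oddB α ∧ not (isSqMod ℓ v))

RamifiedAt : ℕ → ℤ → ℤ → Set
RamifiedAt ℓ a b = Σ ℕ λ α → Σ ℕ λ β → Σ ℤ λ u → Σ ℤ λ v →
  (a ≡ (+ (ℓ ^ α)) ℤ.* u) × (b ≡ (+ (ℓ ^ β)) ℤ.* v)
  × ¬ ((+ ℓ) ∣ℤ u) × ¬ ((+ ℓ) ∣ℤ v) × T (hilbertBit ℓ α β u v)

RamifiedAtInfinity : ℤ → ℤ → Set
RamifiedAtInfinity a b = (a ℤ.< + 0) × (b ℤ.< + 0)

IsBp : ℕ → ℤ → ℤ → Set
IsBp p a b = (a ≢ + 0) × (b ≢ + 0) × RamifiedAtInfinity a b
  × (∀ ℓ → Prime ℓ → (RamifiedAt ℓ a b → ℓ ≡ p) × (ℓ ≡ p → RamifiedAt ℓ a b))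

{-# OPTIONS --safe #-}
-- Write u = 2x − Tr x = x − x̄ and v = y − ȳ with x, y ∈ 𝒪.  As x̄ and ȳ differ from −x and −y
-- by scalars, uv − vu = 4(xy − yx); for pure u and v the pure part of uv is ½(uv − vu), hence
-- equals 2z − Tr z for the commutator z = xy − yx ∈ 𝒪.  Orthogonality: ū = −u, and
-- Tr((uv − vu)u) = Tr(uvu) − Tr(vuu) = 0 because Tr(st) = Tr(ts).
module Submission where

open import Defs
open import Data.Nat using (ℕ)
open import Data.Nat.Primality using (Prime)
open import Data.Integer using (ℤ; +_)
open import Data.Rational as ℚ using (ℚ; 0ℚ; ½; _*_)
open import Data.Product using (_×_; _,_)
open import Data.Fin using (#_)
open import Data.Vec using (Vec; []; _∷_)
open import Relation.Binary.PropositionalEquality using (_≡_; refl)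
open import Data.Rational.Solver using (module +-*-Solver)
open +-*-Solver using (Polynomial; con; var; _:+_; _:*_; _:-_; :-_; prove)

-- The quaternion operations of Defs, transcribed into the polynomial ring ℚ[α, β, x₀…x₃, y₀…y₃]
-- so that identities between them become instances of the commutative-ring solver.
module Formal where
  P : Set
  P = Polynomial 10

  record FQuat : Set where
    constructor ⟪_,_,_,_⟫
    field
      f₀ f₁ f₂ f₃ : P
  open FQuat public

  α β : P
  α = var (# 0)
  β = var (# 1)

  X Y : FQuat
  X = ⟪ var (# 2) , var (# 3) , var (# 4) , var (# 5) ⟫
  Y = ⟪ var (# 6) , var (# 7) , var (# 8) , var (# 9) ⟫

  dropScalar : FQuat → FQuat
  dropScalar ⟪ _ , w1 , w2 , w3 ⟫ = ⟪ con 0ℚ , w1 , w2 , w3 ⟫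

  _+F_ _*F_ _-F_ : FQuat → FQuat → FQuat
  ⟪ x0 , x1 , x2 , x3 ⟫ +F ⟪ y0 , y1 , y2 , y3 ⟫ =
    ⟪ x0 :+ y0 , x1 :+ y1 , x2 :+ y2 , x3 :+ y3 ⟫
  ⟪ x0 , x1 , x2 , x3 ⟫ *F ⟪ y0 , y1 , y2 , y3 ⟫ =
    ⟪ x0 :* y0 :+ α :* (x1 :* y1) :+ β :* (x2 :* y2) :- (α :* β) :* (x3 :* y3)
    , x0 :* y1 :+ x1 :* y0 :- β :* (x2 :* y3) :+ β :* (x3 :* y2)
    , x0 :* y2 :+ x2 :* y0 :+ α :* (x1 :* y3) :- α :* (x3 :* y1)
    , x0 :* y3 :+ x3 :* y0 :+ x1 :* y2 :- x2 :* y1 ⟫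
  x -F ⟪ y0 , y1 , y2 , y3 ⟫ = x +F ⟪ :- y0 , :- y1 , :- y2 , :- y3 ⟫

  ιF : P → FQuat
  ιF q = ⟪ q , con 0ℚ , con 0ℚ , con 0ℚ ⟫

  conjF : FQuat → FQuat
  conjF ⟪ x0 , x1 , x2 , x3 ⟫ = ⟪ x0 , :- x1 , :- x2 , :- x3 ⟫

  TrF : FQuat → P
  TrF x = f₀ (x +F conjF x)

  pureF twice-pureF : FQuat → FQuat
  pureF w = w -F ιF (con ½ :* TrF w)
  twice-pureF y = (ιF (con (+ 2 ℚ./ 1)) *F y) -F ιF (TrF y)

module QuatPure (a b : ℤ) where
  open QuatAlg a b
  open Formal

  pure : Quat → Quat
  pure w = w -Q ι (½ * Tr w)

  twice-pure : Quat → Quat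
  twice-pure y = ((+ 2 ℚ./ 1) ·Q y) -Q ι (Tr y)

  commutator : Quat → Quat → Quat
  commutator x y = (x *Q y) -Q (y *Q x)

  Pure : Quat → Set
  Pure w = x₀ w ≡ 0ℚ

  commutator-closed : ∀ {O : Subset} → IsSubring O →
    ∀ {x y} → O x → O y → O (commutator x y)
  commutator-closed (_ , add , neg , mul) Ox Oy =
    add _ _ (mul _ _ Ox Oy) (neg _ (mul _ _ Oy Ox))

  private
    env : Quat → Quat → Vec ℚ 10
    env x y = (a ℚ./ 1) ∷ (b ℚ./ 1) ∷ x₀ x ∷ x₁ x ∷ x₂ x ∷ x₃ x ∷ x₀ y ∷ x₁ y ∷ x₂ y ∷ x₃ y ∷ []

    ⟨⟩-cong : ∀ {w0 w1 w2 w3 w0' w1' w2' w3' : ℚ} →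
      w0 ≡ w0' → w1 ≡ w1' → w2 ≡ w2' → w3 ≡ w3' →
      ⟨ w0 , w1 , w2 , w3 ⟩ ≡ ⟨ w0' , w1' , w2' , w3' ⟩
    ⟨⟩-cong refl refl refl refl = refl

  twice-pure-pure : ∀ y → Pure (twice-pure y)
  twice-pure-pure y = prove (env y y) (f₀ (twice-pureF X)) (con 0ℚ) refl

  pure-twice-pure-product : ∀ x y →
    pure (twice-pure x *Q twice-pure y) ≡ twice-pure (commutator x y)
  pure-twice-pure-product x y =
    ⟨⟩-cong (prove ρ (f₀ lhs) (f₀ rhs) refl) (prove ρ (f₁ lhs) (f₁ rhs) refl)
            (prove ρ (f₂ lhs) (f₂ rhs) refl) (prove ρ (f₃ lhs) (f₃ rhs) refl)
    where
      ρ : Vec ℚ 10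
      ρ = env x y
      lhs rhs : FQuat
      lhs = pureF (twice-pureF X *F twice-pureF Y)
      rhs = twice-pureF ((X *F Y) -F (Y *F X))

  pure-product-⊥ : ∀ u v → Pure u → Pure v → ⊥⟨ u , v ⟩ (pure (u *Q v))
  pure-product-⊥ u@(⟨ _ , _ , _ , _ ⟩) v@(⟨ _ , _ , _ , _ ⟩) refl refl =
    prove ρ (TrF (w *F conjF U)) (con 0ℚ) refl , prove ρ (TrF (w *F conjF V)) (con 0ℚ) refl
    where
      ρ : Vec ℚ 10
      ρ = env u v
      U V w : FQuat
      U = dropScalar X
      V = dropScalar Y
      w = pureF (U *F V)

lemma4p8 : (p : ℕ) → Prime p → (a b : ℤ) → IsBp p a b →
    let open QuatAlg a b in
    (O : Subset) → IsMaximalOrder O →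
    (u v : Quat) → (O ᵀ) u → (O ᵀ) v →
    (O ᵀ) ((u *Q v) -Q ι (½ * Tr (u *Q v)))
      × ⊥⟨ u , v ⟩ ((u *Q v) -Q ι (½ * Tr (u *Q v)))
lemma4p8 _ _ a b _ _ ((subring , _) , _) _ _ (x , Ox , refl) (y , Oy , refl) =
  ( commutator x y , commutator-closed subring Ox Oy , pure-twice-pure-product x y )
  , pure-product-⊥ _ _ (twice-pure-pure x) (twice-pure-pure y)
  where open QuatPure a b
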